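{- Let $d\ge3$ be odd and $\mu$ a bar partition. For any hook $z\in B(D(\mu))$ and any $0\le i,j\le d-1$: if $z\in H_{i\to j}(D(\mu))$, then $z^*\in H_{j^*\to i^*}(D(\mu))$.
   Context: $\mu=(a_1>\dots>a_m>0)$ is a partition into distinct parts. Its doubled partition $D(\mu)$ is the partition with Frobenius symbol $(a_1,\dots,a_m\mid a_1-1,\dots,a_m-1)$; for $r\le m$, row $r$ has length $a_r+r$ and column $r$ has length $a_r+r-1$. Young diagrams are in English convention, with node $(r,c)$ in row $r$, column $c$. The hook at node $(r,c)$ of a partition $\nu$ has hand node $(r,\nu_r)$ and foot node $(\nu'_c,c)$, where $\nu'_c$ is the length of column $c$. The residue of node $(r,c)$ is $[c-r]_d$, the least non-negative integer congruent to $c-r$ mod $d$. $H_{i\to j}(\nu)$ is the set of hooks whose hand node has residue $i$ and whose foot node has residue $[j+1]_d$. $B(D(\mu))$ is the set of hooks of $D(\mu)$ at the nodes $(r,c)$ with $1\le r\le m$, $r<c\le r+a_r$ and $c\ne m+1$. For the hook $z$ at such a node $(r,c)$, $z^*$ denotes the hook of $D(\mu)$ at node $(c,r)$ if $c\le m$, and at node $(c-1,r)$ if $c\ge m+2$. The hooks $z^*$ lie below the diagonal and have the same length as $z$. For $1\le i\le d-1$, $i^*=d-i$; also $0^*=0$. -}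

module Defs where

open import Data.Nat using (ℕ; zero; suc; _+_; _∸_; _≤_; _<_; _≤?_; NonZero)
open import Data.Integer as ℤ using (ℤ; +_; _%ℕ_)
open import Data.List using (List; []; _∷_; length; filter)
open import Data.List.Relation.Unary.All using (All)
open import Data.List.Relation.Unary.Linked using (Linked)
open import Data.Product using (_×_; _,_)
open import Relation.Nullary using (¬_)
open import Relation.Binary.PropositionalEquality using (_≡_)

IsBarPartition : List ℕ → Set
IsBarPartition μ = Linked (λ x y → y < x) μ × All (λ x → 0 < x) μ

-- 1-based indexing of parts:  part μ r = a_r  (and 0 out of range).
part : List ℕ → ℕ → ℕ
part []       _             = 0
part (x ∷ xs) zero          = 0
part (x ∷ xs) (suc zero)    = x
part (x ∷ xs) (suc (suc r)) = part xs (suc r)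

oneTo : ℕ → List ℕ
oneTo zero    = []
oneTo (suc n) = oneTo n Data.List.++ (suc n ∷ [])

-- Row lengths of D(μ) = (a₁,…,aₘ | a₁-1,…,aₘ-1) (Frobenius symbol).
-- For r ≤ m row r has length a_r + r; for r > m the row only meets columns
-- c ≤ m, and (r,c) is a node iff r ≤ (length of column c) = a_c + c - 1.
rowLen : List ℕ → ℕ → ℕ
rowLen μ r with r ≤? length μ
... | Relation.Nullary.yes _ = part μ r + r
... | Relation.Nullary.no  _ =
  length (filter (λ c → r ≤? (part μ c + c ∸ 1)) (oneTo (length μ)))

-- Column lengths of D(μ): for c ≤ m column c has length a_c + c - 1; for
-- c > m the column only meets rows r ≤ m, and (r,c) is a node iff c ≤ a_r + r.
colLen : List ℕ → ℕ → ℕ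
colLen μ c with c ≤? length μ
... | Relation.Nullary.yes _ = part μ c + c ∸ 1
... | Relation.Nullary.no  _ =
  length (filter (λ r → c ≤? (part μ r + r)) (oneTo (length μ)))

residue : (d : ℕ) .{{_ : NonZero d}} → ℕ → ℕ → ℕ
residue d r c = ((+ c) ℤ.- (+ r)) %ℕ d

handResidue : (d : ℕ) .{{_ : NonZero d}} → List ℕ → ℕ → ℕ → ℕ
handResidue d μ r c = residue d r (rowLen μ r)

footResidue : (d : ℕ) .{{_ : NonZero d}} → List ℕ → ℕ → ℕ → ℕ
footResidue d μ r c = residue d (colLen μ c) c

InH : (d : ℕ) .{{_ : NonZero d}} → List ℕ → ℕ → ℕ → ℕ × ℕ → Set
InH d μ i j (r , c) =
  handResidue d μ r c ≡ i × footResidue d μ r c ≡ ((+ (suc j)) %ℕ d)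

InB : List ℕ → ℕ × ℕ → Set
InB μ (r , c) =
  1 ≤ r × r ≤ length μ × r < c × c ≤ r + part μ r × ¬ (c ≡ suc (length μ))

starNode : List ℕ → ℕ × ℕ → ℕ × ℕ
starNode μ (r , c) with c ≤? length μ
... | Relation.Nullary.yes _ = (c , r)
... | Relation.Nullary.no  _ = (c ∸ 1 , r)

star : ℕ → ℕ → ℕ
star d zero    = zero
star d (suc i) = d ∸ suc i

-- Reading residues as contents c - r mod d, the hand of z (in row r) and the
-- foot of z* (in column r) have contents a_r and 1 - a_r, because row r of
-- D(μ) is one node longer than column r.  Likewise the foot of z and the hand of z* have contents
-- adding up to 1: for c ≤ m this is the same fact for row and column c, and
-- for c ≥ m + 2 column c of D(μ) has the same length as row c - 1.  Since
-- i* ≡ -i (mod d), the residue classes 1 - i and 1 - (j + 1) are [i* + 1]_d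
-- and j*.
module Submission where

open import Defs
open import Data.Nat using (ℕ; _≤_; _<_; _%_; NonZero)
open import Relation.Binary.PropositionalEquality using (_≡_)
open import Data.List using (List)
open import Data.Product using (_,_)

open import Data.Nat as ℕ using (zero; suc; _∸_; _≤?_; s≤s; s≤s⁻¹)
import Data.Nat.Properties as ℕ
open import Data.Nat.DivMod using (m<n⇒m%n≡m)
open import Data.Integer using (+_; _+_; _*_; _-_; -_; _%ℕ_; _/ℕ_; _⊖_; ∣_∣)
open import Data.Integer.Properties
  using (+-injective; abs-*; ∣i∣≡0⇒i≡0; i-j≡0⇒i≡j; m-n≡m⊖n; ∣m⊝n∣≤m⊔n)
open import Data.Integer.DivMod using (n%ℕd<d; a≡a%ℕn+[a/ℕn]*n)
open import Data.Integer.Tactic.RingSolver using (solve-∀)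
open import Data.List using (length; filter)
open import Data.List.Properties using (filter-≐)
open import Data.Product using (Σ-syntax; _×_; proj₁; proj₂)
open import Data.Sum using (inj₁; inj₂)
open import Relation.Nullary using (yes; no; contradiction)
open import Relation.Binary.PropositionalEquality
  using (refl; sym; trans; cong; subst; module ≡-Reasoning)

module _ (d : ℕ) .{{_ : NonZero d}} where

  open ≡-Reasoning

  ∣m⊖n∣<d : ∀ {m n} → m < d → n < d → ∣ m ⊖ n ∣ < d
  ∣m⊖n∣<d {m} {n} m<d n<d = ℕ.≤-<-trans (∣m⊝n∣≤m⊔n m n) (ℕ.⊔-pres-<m m<d n<d)

  k*d<d⇒k≡0 : ∀ k → k ℕ.* d < d → k ≡ 0
  k*d<d⇒k≡0 zero    _     = refl
  k*d<d⇒k≡0 (suc k) k*d<d = contradiction k*d<d (ℕ.m+n≮m d (k ℕ.* d))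

  %ℕ-unique : ∀ {r r′} q q′ → r < d → r′ < d →
              + r + q * + d ≡ + r′ + q′ * + d → r ≡ r′
  %ℕ-unique {r} {r′} q q′ r<d r′<d eq =
    +-injective (i-j≡0⇒i≡j (+ r) (+ r′) (∣i∣≡0⇒i≡0 ∣r-r′∣≡0))
    where
    add-cancel : ∀ a b k e → a - b ≡ (a + k * e) - (b + k * e)
    add-cancel = solve-∀
    sub-cancel : ∀ a k k′ e → (a + k′ * e) - (a + k * e) ≡ (k′ - k) * e
    sub-cancel = solve-∀
    r-r′≡[q′-q]*d : + r - + r′ ≡ (q′ - q) * + d
    r-r′≡[q′-q]*d = begin
      + r - + r′                              ≡⟨ add-cancel (+ r) (+ r′) q (+ d) ⟩
      (+ r + q * + d) - (+ r′ + q * + d)      ≡⟨ cong (_- (+ r′ + q * + d)) eq ⟩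
      (+ r′ + q′ * + d) - (+ r′ + q * + d)    ≡⟨ sub-cancel (+ r′) q q′ (+ d) ⟩
      (q′ - q) * + d                          ∎
    ∣r-r′∣≡∣q′-q∣*d : ∣ + r - + r′ ∣ ≡ ∣ q′ - q ∣ ℕ.* d
    ∣r-r′∣≡∣q′-q∣*d = trans (cong ∣_∣ r-r′≡[q′-q]*d) (abs-* (q′ - q) (+ d))
    ∣r-r′∣<d : ∣ + r - + r′ ∣ < d
    ∣r-r′∣<d = subst (_< d) (cong ∣_∣ (sym (m-n≡m⊖n r r′))) (∣m⊖n∣<d r<d r′<d)
    ∣r-r′∣≡0 : ∣ + r - + r′ ∣ ≡ 0
    ∣r-r′∣≡0 = begin
      ∣ + r - + r′ ∣        ≡⟨ ∣r-r′∣≡∣q′-q∣*d ⟩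
      ∣ q′ - q ∣ ℕ.* d      ≡⟨ cong (ℕ._* d) (k*d<d⇒k≡0 ∣ q′ - q ∣ (subst (_< d) ∣r-r′∣≡∣q′-q∣*d ∣r-r′∣<d)) ⟩
      0                     ∎

  [i+k*d]%ℕd≡i%ℕd : ∀ i k → (i + k * + d) %ℕ d ≡ i %ℕ d
  [i+k*d]%ℕd≡i%ℕd i k =
    %ℕ-unique ((i + k * + d) /ℕ d) (i /ℕ d + k) (n%ℕd<d (i + k * + d) d) (n%ℕd<d i d) (begin
      + ((i + k * + d) %ℕ d) + ((i + k * + d) /ℕ d) * + d  ≡⟨ sym (a≡a%ℕn+[a/ℕn]*n (i + k * + d) d) ⟩
      i + k * + d                                          ≡⟨ cong (_+ k * + d) (a≡a%ℕn+[a/ℕn]*n i d) ⟩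
      (+ (i %ℕ d) + (i /ℕ d) * + d) + k * + d              ≡⟨ assoc (+ (i %ℕ d)) (i /ℕ d) k (+ d) ⟩
      + (i %ℕ d) + (i /ℕ d + k) * + d                      ∎)
    where
    assoc : ∀ a q k e → (a + q * e) + k * e ≡ a + (q + k) * e
    assoc = solve-∀

  %ℕ-≡⇒≡+*d : ∀ i j → i %ℕ d ≡ j %ℕ d → i ≡ j + (i /ℕ d - j /ℕ d) * + d
  %ℕ-≡⇒≡+*d i j i≡j = begin
    i                                                    ≡⟨ a≡a%ℕn+[a/ℕn]*n i d ⟩
    + (i %ℕ d) + (i /ℕ d) * + d                          ≡⟨ cong (λ t → + t + (i /ℕ d) * + d) i≡j ⟩
    + (j %ℕ d) + (i /ℕ d) * + d                          ≡⟨ split (+ (j %ℕ d)) (i /ℕ d) (j /ℕ d) (+ d) ⟩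
    (+ (j %ℕ d) + (j /ℕ d) * + d) + (i /ℕ d - j /ℕ d) * + d
                                                         ≡⟨ cong (_+ (i /ℕ d - j /ℕ d) * + d) (sym (a≡a%ℕn+[a/ℕn]*n j d)) ⟩
    j + (i /ℕ d - j /ℕ d) * + d                          ∎
    where
    split : ∀ a p q e → a + p * e ≡ (a + q * e) + (p - q) * e
    split = solve-∀

  %ℕ-congˡ-+ : ∀ k i j → i %ℕ d ≡ j %ℕ d → (k + i) %ℕ d ≡ (k + j) %ℕ d
  %ℕ-congˡ-+ k i j i≡j = begin
    (k + i) %ℕ d                ≡⟨ cong (λ t → (k + t) %ℕ d) (%ℕ-≡⇒≡+*d i j i≡j) ⟩
    (k + (j + q * + d)) %ℕ d    ≡⟨ cong (_%ℕ d) (assoc k j q (+ d)) ⟩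
    ((k + j) + q * + d) %ℕ d    ≡⟨ [i+k*d]%ℕd≡i%ℕd (k + j) q ⟩
    (k + j) %ℕ d                ∎
    where
    q = i /ℕ d - j /ℕ d
    assoc : ∀ k j q e → k + (j + q * e) ≡ (k + j) + q * e
    assoc = solve-∀

  %ℕ-cong-neg : ∀ i j → i %ℕ d ≡ j %ℕ d → (- i) %ℕ d ≡ (- j) %ℕ d
  %ℕ-cong-neg i j i≡j = begin
    (- i) %ℕ d                  ≡⟨ cong (λ t → (- t) %ℕ d) (%ℕ-≡⇒≡+*d i j i≡j) ⟩
    (- (j + q * + d)) %ℕ d      ≡⟨ cong (_%ℕ d) (neg-distrib j q (+ d)) ⟩
    (- j + (- q) * + d) %ℕ d    ≡⟨ [i+k*d]%ℕd≡i%ℕd (- j) (- q) ⟩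
    (- j) %ℕ d                  ∎
    where
    q = i /ℕ d - j /ℕ d
    neg-distrib : ∀ j q e → - (j + q * e) ≡ - j + (- q) * e
    neg-distrib = solve-∀

  star≡[-i]%ℕd : ∀ {i} → i < d → star d i ≡ (- + i) %ℕ d
  star≡[-i]%ℕd {zero}  0<d   = sym (m<n⇒m%n≡m 0<d)
  star≡[-i]%ℕd {suc i} 1+i<d rewrite m<n⇒m%n≡m 1+i<d = refl

  [1-x]%ℕd≡star[j] : ∀ x {j} → j < d → x %ℕ d ≡ (+ suc j) %ℕ d →
                     (+ 1 - x) %ℕ d ≡ star d j
  [1-x]%ℕd≡star[j] x {j} j<d x≡1+j = begin
    (+ 1 - x) %ℕ d              ≡⟨ %ℕ-congˡ-+ (+ 1) (- x) (- + suc j) (%ℕ-cong-neg x (+ suc j) x≡1+j) ⟩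
    (+ 1 - + suc j) %ℕ d        ≡⟨ cong (_%ℕ d) (1-[1+j]≡-j (+ j)) ⟩
    (- + j) %ℕ d                ≡⟨ sym (star≡[-i]%ℕd j<d) ⟩
    star d j                    ∎
    where
    1-[1+j]≡-j : ∀ j → + 1 - (+ 1 + j) ≡ - j
    1-[1+j]≡-j = solve-∀

  [1-x]%ℕd≡[1+star[i]]%ℕd : ∀ x {i} → i < d → x %ℕ d ≡ i →
                            (+ 1 - x) %ℕ d ≡ (+ suc (star d i)) %ℕ d
  [1-x]%ℕd≡[1+star[i]]%ℕd x {i} i<d x≡i = begin
    (+ 1 - x) %ℕ d                    ≡⟨ %ℕ-congˡ-+ (+ 1) (- x) (- + i) (%ℕ-cong-neg x (+ i) (trans x≡i (sym (m<n⇒m%n≡m i<d)))) ⟩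
    (+ 1 + - + i) %ℕ d                ≡⟨ %ℕ-congˡ-+ (+ 1) (- + i) (+ ((- + i) %ℕ d)) (sym (m<n⇒m%n≡m (n%ℕd<d (- + i) d))) ⟩
    (+ 1 + + ((- + i) %ℕ d)) %ℕ d     ≡⟨ cong (λ t → (+ suc t) %ℕ d) (sym (star≡[-i]%ℕd i<d)) ⟩
    (+ suc (star d i)) %ℕ d           ∎

  residue-reflect : ∀ {a b x y} → a ℕ.+ x ≡ suc (b ℕ.+ y) →
                    residue d y a ≡ (+ 1 - (+ x - + b)) %ℕ d
  residue-reflect {a} {b} {x} {y} a+x≡1+b+y = cong (_%ℕ d) (begin
    + a - + y                               ≡⟨ expand (+ a) (+ x) (+ y) ⟩
    (+ a + + x) - (+ x + + y)               ≡⟨ cong (λ t → + t - (+ x + + y)) a+x≡1+b+y ⟩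
    (+ 1 + (+ b + + y)) - (+ x + + y)       ≡⟨ collapse (+ b) (+ x) (+ y) ⟩
    + 1 - (+ x - + b)                       ∎)
    where
    expand : ∀ a x y → a - y ≡ (a + x) - (x + y)
    expand = solve-∀
    collapse : ∀ b x y → (+ 1 + (b + y)) - (x + y) ≡ + 1 - (x - b)
    collapse = solve-∀

n≡1+[n∸1] : ∀ {n} → 1 ≤ n → n ≡ suc (n ∸ 1)
n≡1+[n∸1] {suc n} _ = refl

module _ (μ : List ℕ) where

  rowLen≡1+colLen : ∀ {r} → 1 ≤ r → r ≤ length μ → rowLen μ r ≡ suc (colLen μ r)
  rowLen≡1+colLen {r} 1≤r r≤m with r ≤? length μ
  ... | yes _   = n≡1+[n∸1] (ℕ.≤-trans 1≤r (ℕ.m≤n+m r (part μ r)))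
  ... | no r≰m = contradiction r≤m r≰m

  1+n≤m∸1⇔2+n≤m : ∀ {n} m → (suc n ≤ m ∸ 1 → suc (suc n) ≤ m) × (suc (suc n) ≤ m → suc n ≤ m ∸ 1)
  1+n≤m∸1⇔2+n≤m zero    = (λ ()) , (λ ())
  1+n≤m∸1⇔2+n≤m (suc m) = s≤s , s≤s⁻¹

  rowLen[c∸1]≡colLen : ∀ {c} → suc (suc (length μ)) ≤ c → rowLen μ (c ∸ 1) ≡ colLen μ c
  rowLen[c∸1]≡colLen {zero}        ()
  rowLen[c∸1]≡colLen {suc zero}    (s≤s ())
  rowLen[c∸1]≡colLen {suc (suc n)} m+2≤c with suc n ≤? length μ | suc (suc n) ≤? length μ
  ... | yes n+1≤m | _       = contradiction n+1≤m (ℕ.≤⇒≯ (s≤s⁻¹ (s≤s⁻¹ m+2≤c)))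
  ... | no _      | yes c≤m = contradiction c≤m (ℕ.<⇒≱ (ℕ.m<n⇒m<1+n (s≤s⁻¹ m+2≤c)))
  ... | no _      | no _    = cong length (filter-≐ _ _
        ((λ {x} → proj₁ (1+n≤m∸1⇔2+n≤m (part μ x ℕ.+ x))) , (λ {x} → proj₂ (1+n≤m∸1⇔2+n≤m (part μ x ℕ.+ x))))
        (oneTo (length μ)))

  starNode≡[c,r] : ∀ {r c} → c ≤ length μ → starNode μ (r , c) ≡ (c , r)
  starNode≡[c,r] {c = c} c≤m with c ≤? length μ
  ... | yes _   = refl
  ... | no c≰m = contradiction c≤m c≰m

  starNode≡[c∸1,r] : ∀ {r c} → length μ < c → starNode μ (r , c) ≡ (c ∸ 1 , r)
  starNode≡[c∸1,r] {c = c} m<c with c ≤? length μ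
  ... | yes c≤m = contradiction c≤m (ℕ.<⇒≱ m<c)
  ... | no _    = refl

  starNode-hand : ∀ {r c} → InB μ (r , c) →
                  Σ[ c′ ∈ ℕ ] starNode μ (r , c) ≡ (c′ , r) × rowLen μ c′ ℕ.+ c ≡ suc (colLen μ c ℕ.+ c′)
  starNode-hand {r} {c} (1≤r , _ , r<c , _ , c≢m+1) with ℕ.≤-<-connex c (length μ)
  ... | inj₁ c≤m = c , starNode≡[c,r] c≤m ,
                   cong (ℕ._+ c) (rowLen≡1+colLen (ℕ.≤-trans 1≤r (ℕ.<⇒≤ r<c)) c≤m)
  ... | inj₂ m<c = c ∸ 1 , starNode≡[c∸1,r] m<c , (begin
    rowLen μ (c ∸ 1) ℕ.+ c              ≡⟨ cong (ℕ._+ c) (rowLen[c∸1]≡colLen m+2≤c) ⟩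
    colLen μ c ℕ.+ c                    ≡⟨ cong (colLen μ c ℕ.+_) (n≡1+[n∸1] (ℕ.≤-trans (s≤s ℕ.z≤n) m<c)) ⟩
    colLen μ c ℕ.+ suc (c ∸ 1)          ≡⟨ ℕ.+-suc (colLen μ c) (c ∸ 1) ⟩
    suc (colLen μ c ℕ.+ (c ∸ 1))        ∎)
    where
    open ≡-Reasoning
    m+2≤c : suc (suc (length μ)) ≤ c
    m+2≤c with ℕ.m≤n⇒m<n∨m≡n m<c
    ... | inj₁ m+1<c = m+1<c
    ... | inj₂ m+1≡c = contradiction (sym m+1≡c) c≢m+1

lemma3p1 : (d : ℕ) .{{_ : NonZero d}} → 3 ≤ d → d % 2 ≡ 1 →
    (μ : List ℕ) → IsBarPartition μ →
    (r c : ℕ) → InB μ (r , c) →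
    (i j : ℕ) → i < d → j < d →
    InH d μ i j (r , c) → InH d μ (star d j) (star d i) (starNode μ (r , c))
lemma3p1 d _ _ μ _ r c z∈B i j i<d j<d (hand , foot)
  with c′ , z*≡ , rowLen[c′]+c≡1+colLen[c]+c′ ← starNode-hand μ z∈B =
  subst (InH d μ (star d j) (star d i)) (sym z*≡) (hand* , foot*)
  where
  hand* : residue d c′ (rowLen μ c′) ≡ star d j
  hand* = trans (residue-reflect d {b = colLen μ c} {x = c} rowLen[c′]+c≡1+colLen[c]+c′)
                ([1-x]%ℕd≡star[j] d (+ c - + colLen μ c) j<d foot)
  r+rowLen[r]≡1+r+colLen[r] : r ℕ.+ rowLen μ r ≡ suc (r ℕ.+ colLen μ r)
  r+rowLen[r]≡1+r+colLen[r] =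
    trans (cong (r ℕ.+_) (rowLen≡1+colLen μ (proj₁ z∈B) (proj₁ (proj₂ z∈B)))) (ℕ.+-suc r (colLen μ r))
  foot* : residue d (colLen μ r) r ≡ (+ suc (star d i)) %ℕ d
  foot* = trans (residue-reflect d {b = r} {x = rowLen μ r} r+rowLen[r]≡1+r+colLen[r])
                ([1-x]%ℕd≡[1+star[i]]%ℕd d (+ rowLen μ r - + r) i<d hand)
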